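{- Let $p\ge5$ be prime. If $1\le\ell\le\frac{p-1}2$, then \[M(\tfrac\ell p;z)=\sum_{T=0}^{\lfloor\frac{p}{2\ell}\rfloor}q^{\frac{T\ell}{p}}+O(q^{\frac12}).\] If $\frac{p+1}2\le\ell\le p-1$, then \[M(\tfrac\ell p;z)=\sum_{T=0}^{\lfloor\frac{p}{2(p-\ell)}\rfloor}q^{T(1-\frac\ell p)}+O(q^{\frac12}).\]
   Context: $q=e^{2\pi iz}$, $z\in\mathbb H$, $(q;q)_\infty=\prod_{j\ge1}(1-q^j)$, and $M(\frac\ell p;z)=\frac{1}{(q;q)_\infty}\sum_{n\in\mathbb Z}\frac{(-1)^nq^{n+\ell/p}}{1-q^{n+\ell/p}}q^{\frac32n(n+1)}$. $O(q^{1/2})$ denotes the remaining terms of the expansion in powers of $q$, all of exponent at least $\frac12$. -}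

module Defs where

open import Data.Bool using (Bool; true; false; if_then_else_)
open import Data.Nat as ℕ using (ℕ; zero; suc; _∸_; _≡ᵇ_; _≤ᵇ_)
open import Data.Integer as ℤ using (ℤ; +_; -_)
open import Data.List using (List; upTo; map; foldr)

-- q-series are represented by coefficient functions: for a fixed prime p,
-- a series  Σ_k c(k) q^(k/p)  (k ≥ 0) is the function  c : ℕ → ℤ.

sumℤ : List ℤ → ℤ
sumℤ = foldr ℤ._+_ (+ 0)

Σ≤ : ℕ → (ℕ → ℤ) → ℤ
Σ≤ n f = sumℤ (map f (upTo (suc n)))

Σ1≤ : ℕ → (ℕ → ℤ) → ℤ
Σ1≤ n f = sumℤ (map (λ i → f (suc i)) (upTo n))

δ : ℕ → ℕ → ℤ
δ a b = if a ≡ᵇ b then + 1 else + 0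

χ≤ : ℕ → ℕ → ℤ
χ≤ a b = if a ≤ᵇ b then + 1 else + 0

sgn : ℕ → ℤ
sgn zero = + 1
sgn (suc i) = - sgn i

tri : ℕ → ℕ
tri zero = zero
tri (suc i) = suc i ℕ.+ tri i

-- Coefficient of q^(k/p) in  Σ_{n∈ℤ} (-1)^n q^(n+ℓ/p)/(1-q^(n+ℓ/p)) q^(3n(n+1)/2),
-- each term expanded as a geometric series in the direction where it converges
-- near q = 0 (ℓ/p ∉ ℤ):
--   n = i ≥ 0 :  (-1)^i Σ_{m≥1} q^(m(i+ℓ/p) + 3 i(i+1)/2)
--   n = -(i+1):  (-1)^(i+1)·(-1) Σ_{m≥0} q^(m(i+1-ℓ/p) + 3 i(i+1)/2)
-- Exponents are measured in units of 1/p.  The ranges 0..k for i and m are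
-- large enough: every omitted (i,m) gives exponent > k.
sumCoeff : ℕ → ℕ → ℕ → ℤ
sumCoeff p ℓ k =
  Σ≤ k (λ i → Σ1≤ k (λ m →
      sgn i ℤ.* δ (m ℕ.* (i ℕ.* p ℕ.+ ℓ) ℕ.+ p ℕ.* (3 ℕ.* tri i)) k))
  ℤ.+
  Σ≤ k (λ i → Σ≤ k (λ m →
      sgn i ℤ.* δ (m ℕ.* (suc i ℕ.* p ∸ ℓ) ℕ.+ p ℕ.* (3 ℕ.* tri i)) k))

-- coefficient of q^t in the finite product Π_{j=1}^{J} 1/(1-q^j)
prodCoeff : ℕ → ℕ → ℤ
prodCoeff t zero = δ t 0
prodCoeff t (suc J) =
  Σ≤ t (λ c → χ≤ (c ℕ.* suc J) t ℤ.* prodCoeff (t ∸ c ℕ.* suc J) J)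

-- coefficient of q^t in 1/(q;q)_∞  (factors with j > t do not affect it)
invEtaCoeff : ℕ → ℤ
invEtaCoeff t = prodCoeff t t

-- coefficient of q^(k/p) in M(ℓ/p; z) = (1/(q;q)_∞) · (the sum above)
Mcoeff : ℕ → ℕ → ℕ → ℤ
Mcoeff p ℓ k =
  Σ≤ k (λ t → χ≤ (t ℕ.* p) k ℤ.* invEtaCoeff t ℤ.* sumCoeff p ℓ (k ∸ t ℕ.* p))

-- coefficient of q^(k/p) in  Σ_{T : 0 ≤ T ≤ ⌊p/(2d)⌋} q^(T d / p)
-- (T ≤ ⌊p/(2d)⌋ ⇔ 2Td ≤ p; such T are ≤ p)
truncCoeff : ℕ → ℕ → ℕ → ℤ
truncCoeff p d k = Σ≤ p (λ T → χ≤ (2 ℕ.* T ℕ.* d) p ℤ.* δ (T ℕ.* d) k)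

-- Only finitely many terms of the double series can reach an exponent k/p < 1/2.
-- A factor q^t with t ≥ 1 from 1/(q;q)_∞ already costs a full unit, and so does
-- the factor q^(3n(n+1)/2) for n ∉ {0, -1}.  What remains is the n = 0 term
-- Σ_{m≥1} q^(mℓ/p) and the n = -1 term Σ_{m≥0} q^(m(1-ℓ/p)); when ℓ < p/2 the
-- second contributes only its constant term, and when ℓ > p/2 the first
-- contributes nothing.
module Submission where

open import Defs
open import Data.Nat using (ℕ; _+_; _*_; _∸_; _≤_; _<_)
open import Data.Nat.Primality using (Prime)
open import Data.Integer using (ℤ)
open import Data.Product using (_×_)
open import Relation.Binary.PropositionalEquality using (_≡_)

open import Data.Bool using (true; false; T)
open import Data.Empty using (⊥-elim)
open import Data.Integer as ℤ using (+_)
import Data.Integer.Properties as ℤₚ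
open import Data.List using ([]; _∷_; map; upTo)
open import Data.List.Properties using (map-cong; map-upTo)
open import Data.Nat using (zero; suc; z≤n; s≤s; _≡ᵇ_; _≤ᵇ_)
open import Data.Nat.Properties
open import Data.Product using (_,_)
open import Function using (_∘_)
open import Relation.Binary.PropositionalEquality
  using (refl; sym; trans; cong; cong₂; subst; module ≡-Reasoning)

sumℤ-map-zero : (f : ℕ → ℤ) → (∀ i → f i ≡ + 0) → ∀ xs → sumℤ (map f xs) ≡ + 0
sumℤ-map-zero f f≡0 [] = refl
sumℤ-map-zero f f≡0 (x ∷ xs) rewrite f≡0 x | sumℤ-map-zero f f≡0 xs = refl

Σ≤-zero : ∀ n f → (∀ i → f i ≡ + 0) → Σ≤ n f ≡ + 0
Σ≤-zero n f f≡0 = sumℤ-map-zero f f≡0 (upTo (suc n))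

Σ1≤-zero : ∀ n f → (∀ i → f (suc i) ≡ + 0) → Σ1≤ n f ≡ + 0
Σ1≤-zero n f f≡0 = sumℤ-map-zero (f ∘ suc) f≡0 (upTo n)

Σ≤-cong : ∀ n {f g} → (∀ i → f i ≡ g i) → Σ≤ n f ≡ Σ≤ n g
Σ≤-cong n f≡g = cong sumℤ (map-cong f≡g (upTo (suc n)))

Σ1≤-cong : ∀ n {f g} → (∀ i → f (suc i) ≡ g (suc i)) → Σ1≤ n f ≡ Σ1≤ n g
Σ1≤-cong n f≡g = cong sumℤ (map-cong f≡g (upTo n))

Σ≤-head : ∀ n f → Σ≤ n f ≡ f 0 ℤ.+ Σ1≤ n f
Σ≤-head n f = cong sumℤ (trans (map-upTo f (suc n)) (cong (f 0 ∷_) (sym (map-upTo (f ∘ suc) n))))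

Σ≤-only-head : ∀ n f → (∀ i → f (suc i) ≡ + 0) → Σ≤ n f ≡ f 0
Σ≤-only-head n f tail≡0 = begin
  Σ≤ n f               ≡⟨ Σ≤-head n f ⟩
  f 0 ℤ.+ Σ1≤ n f      ≡⟨ cong (ℤ._+_ (f 0)) (Σ1≤-zero n f tail≡0) ⟩
  f 0 ℤ.+ + 0          ≡⟨ ℤₚ.+-identityʳ (f 0) ⟩
  f 0                  ∎
  where open ≡-Reasoning

Σ≤-extend : ∀ {n m} f → n ≤ m → (∀ i → n < i → f i ≡ + 0) → Σ≤ m f ≡ Σ≤ n f
Σ≤-extend {zero} {m} f _ tail≡0 =
  trans (Σ≤-head m f) (cong (ℤ._+_ (f 0)) (Σ1≤-zero m f (λ i → tail≡0 (suc i) (s≤s z≤n))))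
Σ≤-extend {suc n} {suc m} f (s≤s n≤m) tail≡0 = begin
  Σ≤ (suc m) f                 ≡⟨ Σ≤-head (suc m) f ⟩
  f 0 ℤ.+ Σ≤ m (f ∘ suc)       ≡⟨ cong (ℤ._+_ (f 0)) (Σ≤-extend (f ∘ suc) n≤m (λ i → tail≡0 (suc i) ∘ s≤s)) ⟩
  f 0 ℤ.+ Σ≤ n (f ∘ suc)       ≡⟨ Σ≤-head (suc n) f ⟨
  Σ≤ (suc n) f                 ∎
  where open ≡-Reasoning

k<a⇒δ≡0 : ∀ {a k} → k < a → δ a k ≡ + 0
k<a⇒δ≡0 {suc a} {zero} _ = refl
k<a⇒δ≡0 {suc a} {suc k} (s≤s k<a) = k<a⇒δ≡0 k<a

b<a⇒χ≤≡0 : ∀ {a b} → b < a → χ≤ a b ≡ + 0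
b<a⇒χ≤≡0 {a} {b} b<a with a ≤ᵇ b in eq
... | false = refl
... | true  = ⊥-elim (<⇒≱ b<a (≤ᵇ⇒≤ a b (subst T (sym eq) _)))

a≤b⇒χ≤≡1 : ∀ {a b} → a ≤ b → χ≤ a b ≡ + 1
a≤b⇒χ≤≡1 {a} {b} a≤b with a ≤ᵇ b in eq
... | true  = refl
... | false = ⊥-elim (subst T eq (≤⇒≤ᵇ a≤b))

χ≤-*-δ : ∀ c b a k → (a ≡ k → c ≤ b) → χ≤ c b ℤ.* δ a k ≡ δ a k
χ≤-*-δ c b a k c≤b with a ≡ᵇ k in eq
... | false = ℤₚ.*-zeroʳ (χ≤ c b)
... | true rewrite a≤b⇒χ≤≡1 (c≤b (≡ᵇ⇒≡ a k (subst T (sym eq) _))) = refl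

*-δ-beyond : ∀ s {a k} → k < a → s ℤ.* δ a k ≡ + 0
*-δ-beyond s k<a = trans (cong (s ℤ.*_) (k<a⇒δ≡0 k<a)) (ℤₚ.*-zeroʳ s)

geomCoeff : ℕ → ℕ → ℕ → ℤ
geomCoeff n d k = Σ≤ n (λ m → δ (m * d) k)

Σ1≤-δ-multiple-beyond : ∀ n {d k} → k < d → Σ1≤ n (λ m → δ (m * d) k) ≡ + 0
Σ1≤-δ-multiple-beyond n {d} {k} k<d =
  Σ1≤-zero n (λ m → δ (m * d) k) (λ m → k<a⇒δ≡0 (<-≤-trans k<d (m≤m+n d (m * d))))

geomCoeff-beyond : ∀ n {d k} → k < d → geomCoeff n d k ≡ δ 0 k
geomCoeff-beyond n {d} {k} k<d = begin
  geomCoeff n d k                          ≡⟨ Σ≤-head n (λ m → δ (m * d) k) ⟩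
  δ 0 k ℤ.+ Σ1≤ n (λ m → δ (m * d) k)      ≡⟨ cong (ℤ._+_ (δ 0 k)) (Σ1≤-δ-multiple-beyond n k<d) ⟩
  δ 0 k ℤ.+ + 0                            ≡⟨ ℤₚ.+-identityʳ (δ 0 k) ⟩
  δ 0 k                                    ∎
  where open ≡-Reasoning

truncCoeff≡geomCoeff : ∀ p {d} k → 1 ≤ d → 2 * k ≤ p → truncCoeff p d k ≡ geomCoeff k d k
truncCoeff≡geomCoeff p {d@(suc _)} k _ 2k≤p = begin
  truncCoeff p d k  ≡⟨ Σ≤-cong p (λ T → χ≤-*-δ _ p (T * d) k (2T*d≤p T)) ⟩
  geomCoeff p d k   ≡⟨ Σ≤-extend (λ m → δ (m * d) k) k≤p (λ m k<m → k<a⇒δ≡0 (<-≤-trans k<m (m≤m*n m d))) ⟩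
  geomCoeff k d k   ∎
  where
  open ≡-Reasoning
  k≤p : k ≤ p
  k≤p = ≤-trans (m≤m+n k (k + 0)) 2k≤p
  2T*d≤p : ∀ T → T * d ≡ k → 2 * T * d ≤ p
  2T*d≤p T T*d≡k = subst (_≤ p) (trans (cong (2 *_) (sym T*d≡k)) (sym (*-assoc 2 T d))) 2k≤p

Mcoeff≡sumCoeff : ∀ p ℓ k → k < p → Mcoeff p ℓ k ≡ sumCoeff p ℓ k
Mcoeff≡sumCoeff p ℓ k k<p =
  trans (Σ≤-only-head k term higher-t-vanish) (ℤₚ.*-identityˡ (sumCoeff p ℓ k))
  where
  term : ℕ → ℤ
  term t = χ≤ (t * p) k ℤ.* invEtaCoeff t ℤ.* sumCoeff p ℓ (k ∸ t * p)
  higher-t-vanish : ∀ t → term (suc t) ≡ + 0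
  higher-t-vanish t rewrite b<a⇒χ≤≡0 (<-≤-trans k<p (m≤m+n p (t * p))) = refl

sgn0-*-δ : ∀ p x k → sgn 0 ℤ.* δ (x + p * (3 * tri 0)) k ≡ δ x k
sgn0-*-δ p x k = trans (ℤₚ.*-identityˡ _)
  (cong (λ a → δ a k) (trans (cong (_+_ x) (*-zeroʳ p)) (+-identityʳ x)))

*-δ-pentagonal-beyond : ∀ s p i x k → k < p → s ℤ.* δ (x + p * (3 * tri (suc i))) k ≡ + 0
*-δ-pentagonal-beyond s p i x k k<p =
  *-δ-beyond s (<-≤-trans k<p (≤-trans (m≤m*n p (3 * tri (suc i))) (m≤n+m _ x)))

sumCoeff≡n=0+n=-1 : ∀ p ℓ k → k < p →
  sumCoeff p ℓ k ≡ Σ1≤ k (λ m → δ (m * ℓ) k) ℤ.+ geomCoeff k (p ∸ ℓ) k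
sumCoeff≡n=0+n=-1 p ℓ k k<p = cong₂ ℤ._+_
  (trans (Σ≤-only-head k (λ i → Σ1≤ k (n≥0-term i))
            (λ i → Σ1≤-zero k (n≥0-term (suc i))
               (λ m → *-δ-pentagonal-beyond (sgn (suc i)) p i (suc m * (suc i * p + ℓ)) k k<p)))
         (Σ1≤-cong k {n≥0-term 0} {λ m → δ (m * ℓ) k} (λ m → sgn0-*-δ p (suc m * ℓ) k)))
  (trans (Σ≤-only-head k (λ i → Σ≤ k (n<0-term i))
            (λ i → Σ≤-zero k (n<0-term (suc i))
               (λ m → *-δ-pentagonal-beyond (sgn (suc i)) p i (m * (suc (suc i) * p ∸ ℓ)) k k<p)))
         (Σ≤-cong k {n<0-term 0} (λ m → trans (sgn0-*-δ p (m * (1 * p ∸ ℓ)) k)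
                                 (cong (λ d → δ (m * (d ∸ ℓ)) k) (*-identityˡ p)))))
  where
  n≥0-term n<0-term : ℕ → ℕ → ℤ
  n≥0-term i m = sgn i ℤ.* δ (m * (i * p + ℓ) + p * (3 * tri i)) k
  n<0-term i m = sgn i ℤ.* δ (m * (suc i * p ∸ ℓ) + p * (3 * tri i)) k

Mcoeff≡n=0+n=-1 : ∀ p ℓ k → k < p →
  Mcoeff p ℓ k ≡ Σ1≤ k (λ m → δ (m * ℓ) k) ℤ.+ geomCoeff k (p ∸ ℓ) k
Mcoeff≡n=0+n=-1 p ℓ k k<p = trans (Mcoeff≡sumCoeff p ℓ k k<p) (sumCoeff≡n=0+n=-1 p ℓ k k<p)

Mcoeff≡geomCoeff-small : ∀ p ℓ k → k < p → k < p ∸ ℓ → Mcoeff p ℓ k ≡ geomCoeff k ℓ k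
Mcoeff≡geomCoeff-small p ℓ k k<p k<p∸ℓ = begin
  Mcoeff p ℓ k                   ≡⟨ Mcoeff≡n=0+n=-1 p ℓ k k<p ⟩
  n=0-part ℤ.+ geomCoeff k (p ∸ ℓ) k
                                 ≡⟨ cong (ℤ._+_ n=0-part) (geomCoeff-beyond k k<p∸ℓ) ⟩
  n=0-part ℤ.+ δ 0 k             ≡⟨ ℤₚ.+-comm n=0-part (δ 0 k) ⟩
  δ 0 k ℤ.+ n=0-part             ≡⟨ Σ≤-head k (λ m → δ (m * ℓ) k) ⟨
  geomCoeff k ℓ k                ∎
  where
  open ≡-Reasoning
  n=0-part : ℤ
  n=0-part = Σ1≤ k (λ m → δ (m * ℓ) k)

Mcoeff≡geomCoeff-large : ∀ p ℓ k → k < p → k < ℓ → Mcoeff p ℓ k ≡ geomCoeff k (p ∸ ℓ) k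
Mcoeff≡geomCoeff-large p ℓ k k<p k<ℓ = begin
  Mcoeff p ℓ k                   ≡⟨ Mcoeff≡n=0+n=-1 p ℓ k k<p ⟩
  Σ1≤ k (λ m → δ (m * ℓ) k) ℤ.+ n=-1-part
                                 ≡⟨ cong (ℤ._+ n=-1-part) (Σ1≤-δ-multiple-beyond k k<ℓ) ⟩
  + 0 ℤ.+ n=-1-part              ≡⟨ ℤₚ.+-identityˡ n=-1-part ⟩
  n=-1-part                      ∎
  where
  open ≡-Reasoning
  n=-1-part : ℤ
  n=-1-part = geomCoeff k (p ∸ ℓ) k

halves-< : ∀ {p a b} → 2 * a < p → 2 * b ≤ p → a + b < p
halves-< {p} {a} {b} 2a<p 2b≤p = *-cancelˡ-< 2 (a + b) p (begin-strict
  2 * (a + b)     ≡⟨ *-distribˡ-+ 2 a b ⟩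
  2 * a + 2 * b   <⟨ +-mono-<-≤ 2a<p 2b≤p ⟩
  p + p           ≡⟨ cong (_+_ p) (+-identityʳ p) ⟨
  2 * p           ∎)
  where open ≤-Reasoning

lemma5p1 : (p : ℕ) → Prime p → 5 ≤ p → (ℓ : ℕ) →
    ((1 ≤ ℓ × 2 * ℓ ≤ p ∸ 1) →
      (k : ℕ) → 2 * k < p → Mcoeff p ℓ k ≡ truncCoeff p ℓ k)
    ×
    ((p + 1 ≤ 2 * ℓ × ℓ ≤ p ∸ 1) →
      (k : ℕ) → 2 * k < p → Mcoeff p ℓ k ≡ truncCoeff p (p ∸ ℓ) k)
lemma5p1 p@(suc p-1) _ _ ℓ = ℓ-small , ℓ-large
  where
  k<p : ∀ {k} → 2 * k < p → k < p
  k<p {k} = ≤-<-trans (m≤m+n k (k + 0))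

  ℓ-small : 1 ≤ ℓ × 2 * ℓ ≤ p-1 → ∀ k → 2 * k < p → Mcoeff p ℓ k ≡ truncCoeff p ℓ k
  ℓ-small (1≤ℓ , 2ℓ≤p-1) k 2k<p = trans
    (Mcoeff≡geomCoeff-small p ℓ k (k<p 2k<p) k<p∸ℓ)
    (sym (truncCoeff≡geomCoeff p k 1≤ℓ (<⇒≤ 2k<p)))
    where
    k<p∸ℓ : k < p ∸ ℓ
    k<p∸ℓ = m+n≤o⇒m≤o∸n (suc k) (halves-< {a = k} {ℓ} 2k<p (m≤n⇒m≤1+n 2ℓ≤p-1))

  ℓ-large : p + 1 ≤ 2 * ℓ × ℓ ≤ p-1 → ∀ k → 2 * k < p → Mcoeff p ℓ k ≡ truncCoeff p (p ∸ ℓ) k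
  ℓ-large (p+1≤2ℓ , ℓ≤p-1) k 2k<p = trans
    (Mcoeff≡geomCoeff-large p ℓ k (k<p 2k<p) k<ℓ)
    (sym (truncCoeff≡geomCoeff p k (m<n⇒0<n∸m (s≤s ℓ≤p-1)) (<⇒≤ 2k<p)))
    where
    k<ℓ : k < ℓ
    k<ℓ = *-cancelˡ-< 2 k ℓ (<-≤-trans 2k<p (≤-trans (m≤m+n p 1) p+1≤2ℓ))
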